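{- If $T$ is a tree, then $\mathrm{czf}(T)=\alpha(T)$, where $\alpha(T)$ is the independence number of $T$.
   Context: All graphs are finite and simple. Constrained zero forcing: start with a set $S\subseteq V(G)$ of colored vertices, all others uncolored. A colored vertex $c$ may force an uncolored vertex $u$ to become colored if $u$ is the only uncolored neighbor of $c$; only vertices of the initial set $S$ may ever force. $S$ is a constrained zero forcing set if some sequence of forces colors all vertices. $\mathrm{czf}(G)$ is the minimum size of a constrained zero forcing set. $\alpha(G)$ is the maximum size of a set of pairwise non-adjacent vertices. -}

module Defs where

open import Data.Nat using (ℕ; _≤_; _≥_; suc)
open import Data.Fin using (Fin)
open import Data.Fin.Subset using (Subset; _∈_; _∉_; _∪_; ⁅_⁆; ⊤; ∣_∣)
open import Data.Bool using (Bool; true; false)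
open import Data.List using (List; []; _∷_; length)
open import Data.List.Relation.Unary.Unique.Propositional using (Unique)
open import Data.Product using (Σ; _×_; ∃)
open import Relation.Binary.PropositionalEquality using (_≡_; _≢_)
open import Relation.Nullary using (¬_)
open import Data.Empty using (⊥)

record Graph (n : ℕ) : Set where
  field
    adj     : Fin n → Fin n → Bool
    adj-sym : ∀ u v → adj u v ≡ adj v u
    adj-irr : ∀ v → adj v v ≡ false
open Graph public

module _ {n : ℕ} (G : Graph n) where

  Adj : Fin n → Fin n → Set
  Adj u v = adj G u v ≡ true

  data Walk : Fin n → Fin n → Set where
    here : ∀ {v} → Walk v v
    step : ∀ {u w v} → Adj u w → Walk w v → Walk u v

  Connected : Set
  Connected = ∀ u v → Walk u v

  -- consecutive vertices of the list are adjacent, ending at the given vertex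
  -- (ChainTo first x vs : x followed by vs is a path whose last vertex is adjacent to first)
  ChainTo : Fin n → Fin n → List (Fin n) → Set
  ChainTo first x []       = Adj x first
  ChainTo first x (y ∷ ys) = Adj x y × ChainTo first y ys

  IsCycle : List (Fin n) → Set
  IsCycle []       = ⊥
  IsCycle (v ∷ vs) = Unique (v ∷ vs) × 3 ≤ length (v ∷ vs) × ChainTo v v vs

  Acyclic : Set
  Acyclic = ∀ cs → ¬ IsCycle cs

  IsTree : Set
  IsTree = Connected × Acyclic

  Independent : Subset n → Set
  Independent S = ∀ u v → u ∈ S → v ∈ S → ¬ Adj u v

  IsIndependenceNumber : ℕ → Set
  IsIndependenceNumber k =
    (Σ (Subset n) λ S → Independent S × ∣ S ∣ ≡ k) ×
    (∀ S → Independent S → ∣ S ∣ ≤ k)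

  -- constrained zero forcing with initial set S: a single force
  -- c → u where c ∈ S (only initial vertices force; they are colored),
  -- u is uncolored and u is the only uncolored neighbour of c.
  data Force (S : Subset n) (C : Subset n) : Subset n → Set where
    force : ∀ c u → c ∈ S → u ∉ C → Adj c u →
            (∀ w → Adj c w → w ≢ u → w ∈ C) →
            Force S C (C ∪ ⁅ u ⁆)

  data Forces (S : Subset n) : Subset n → Subset n → Set where
    done : ∀ {C} → Forces S C C
    more : ∀ {C D E} → Force S C D → Forces S D E → Forces S C E

  IsCZFSet : Subset n → Set
  IsCZFSet S = Forces S S ⊤

  IsCZFNumber : ℕ → Set
  IsCZFNumber k =
    (Σ (Subset n) λ S → IsCZFSet S × ∣ S ∣ ≡ k) ×
    (∀ S → IsCZFSet S → k ≤ ∣ S ∣)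

-- Lower bound, valid in every graph: while S forces, let pending(C) be the set
-- of vertices of S that still have an uncoloured neighbour in J. A force into
-- J leaves its forcer without uncoloured neighbours, so the forcer drops out of
-- pending(C) for good; hence |J ∖ C| ≤ |pending(C)| along any successful
-- forcing. If J is independent then pending(S) ⊆ S ∖ J, so at C = S we get
-- |J| ≤ |S ∖ J| + |J ∩ S| = |S|.
-- Upper bound: in a forest every non-empty vertex set R has a vertex ℓ with at
-- most one neighbour p in R (the end of a maximal path). Put ℓ into the
-- independent set and delete ℓ and p from R; once all vertices outside R are
-- coloured, ℓ can force p, so the independent set built recursively is a
-- constrained zero forcing set.
module Submission where

open import Defs
open import Data.Bool as Bool using ()
open import Data.Fin using (Fin; zero; suc; _≟_)
open import Data.Fin.Properties using (any?; ≡-decSetoid)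
open import Data.Fin.Subset
open import Data.Fin.Subset.Induction using (Acc; acc; ⊂-wellFounded)
open import Data.Fin.Subset.Properties
open import Data.List using (List; []; _∷_)
import Data.List.Countdown as Countdown
import Data.List.Membership.DecPropositional as DecMembership
open import Data.List.Membership.Propositional using () renaming (_∈_ to _∈ₗ_; _∉_ to _∉ₗ_)
open import Data.List.Relation.Binary.Sublist.Propositional as Sublist using ([]; _∷ʳ_; _∷_; minimum)
open import Data.List.Relation.Binary.Sublist.Propositional.Properties using (All-resp-⊆)
open import Data.List.Relation.Unary.All using (All; []; _∷_)
open import Data.List.Relation.Unary.All.Properties using (¬Any⇒All¬)
open import Data.List.Relation.Unary.AllPairs using ([]; _∷_)
open import Data.List.Relation.Unary.Any using (here; there)
open import Data.List.Relation.Unary.Linked using (Linked; [-]; _∷_)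
open import Data.List.Relation.Unary.Unique.Propositional using (Unique)
open import Data.List.Relation.Unary.Unique.Propositional.Properties using (Unique[x∷xs]⇒x∉xs)
open import Data.Nat using (ℕ; zero; suc; _+_; _≤_; z≤n; s≤s)
open import Data.Nat.Properties using (module ≤-Reasoning; +-suc; +-comm; +-monoˡ-≤; +-monoʳ-≤)
import Data.Product as Product
open import Data.Product using (Σ; ∃; ∃₂; _×_; _,_; proj₁; proj₂)
open import Data.Sum using (inj₁; inj₂; [_,_])
open import Data.Vec using ([]; _∷_; here; there)
open import Function using (_∘_)
open import Function.Construct.Identity using (↣-id)
open import Level using (Level; 0ℓ)
open import Relation.Binary.PropositionalEquality using (_≡_; _≢_; refl; sym; trans; cong; subst)
import Relation.Binary.Reasoning.PartialOrder as ⊆-Reasoning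
open import Relation.Nullary using (¬_; Dec; yes; no; does; ¬?; _×-dec_; contradiction)
open import Relation.Unary using (Pred; Decidable)

Unique-resp-⊆ : ∀ {a} {A : Set a} {xs ys : List A} → ys Sublist.⊆ xs → Unique xs → Unique ys
Unique-resp-⊆ []             []        = []
Unique-resp-⊆ (_ ∷ʳ ys⊆xs)   (_ ∷ u)   = Unique-resp-⊆ ys⊆xs u
Unique-resp-⊆ (refl ∷ ys⊆xs) (x∉ ∷ u) = All-resp-⊆ ys⊆xs x∉ ∷ Unique-resp-⊆ ys⊆xs u

subsetOf : ∀ {n ℓ} {P : Pred (Fin n) ℓ} → Decidable P → Subset n
subsetOf {zero}  P? = []
subsetOf {suc n} P? = does (P? zero) ∷ subsetOf (P? ∘ suc)

module _ {ℓ : Level} where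

  ∈-subsetOf⁺ : ∀ {n} {P : Pred (Fin n) ℓ} (P? : Decidable P) {x} → P x → x ∈ subsetOf P?
  ∈-subsetOf⁺ {suc n} P? {zero} px with P? zero
  ... | yes _  = here
  ... | no ¬px = contradiction px ¬px
  ∈-subsetOf⁺ {suc n} P? {suc x} px = there (∈-subsetOf⁺ (P? ∘ suc) px)

  ∈-subsetOf⁻ : ∀ {n} {P : Pred (Fin n) ℓ} (P? : Decidable P) {x} → x ∈ subsetOf P? → P x
  ∈-subsetOf⁻ {suc n} P? {zero} x∈ with P? zero | x∈
  ... | yes px | _ = px
  ∈-subsetOf⁻ {suc n} P? {suc x} (there x∈) = ∈-subsetOf⁻ (P? ∘ suc) x∈

∣p∣≡∣p∩∁q∣+∣p∩q∣ : ∀ {n} (p q : Subset n) → ∣ p ∣ ≡ ∣ p ∩ ∁ q ∣ + ∣ p ∩ q ∣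
∣p∣≡∣p∩∁q∣+∣p∩q∣ []             []             = refl
∣p∣≡∣p∩∁q∣+∣p∩q∣ (outside ∷ p) (_ ∷ q)        = ∣p∣≡∣p∩∁q∣+∣p∩q∣ p q
∣p∣≡∣p∩∁q∣+∣p∩q∣ (inside ∷ p)  (outside ∷ q) = cong suc (∣p∣≡∣p∩∁q∣+∣p∩q∣ p q)
∣p∣≡∣p∩∁q∣+∣p∩q∣ (inside ∷ p)  (inside ∷ q)  =
  trans (cong suc (∣p∣≡∣p∩∁q∣+∣p∩q∣ p q)) (sym (+-suc ∣ p ∩ ∁ q ∣ ∣ p ∩ q ∣))

x∈p-y⇒x≢y : ∀ {n x y} {p : Subset n} → x ∈ p - y → x ≢ y
x∈p-y⇒x≢y {y = zero}  {_ ∷ _} (there _) ()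
x∈p-y⇒x≢y {y = suc y} {_ ∷ _} here       ()
x∈p-y⇒x≢y {y = suc y} {_ ∷ _} (there x∈) refl = x∈p-y⇒x≢y x∈ refl

module _ {n : ℕ} where

  ∣p∣≤1+∣p∩∁⁅x⁆∣ : ∀ (p : Subset n) x → ∣ p ∣ ≤ suc ∣ p ∩ ∁ ⁅ x ⁆ ∣
  ∣p∣≤1+∣p∩∁⁅x⁆∣ p x = begin
    ∣ p ∣                               ≡⟨ ∣p∣≡∣p∩∁q∣+∣p∩q∣ p ⁅ x ⁆ ⟩
    ∣ p ∩ ∁ ⁅ x ⁆ ∣ + ∣ p ∩ ⁅ x ⁆ ∣     ≤⟨ +-monoʳ-≤ ∣ p ∩ ∁ ⁅ x ⁆ ∣ (∣p∩q∣≤∣q∣ p ⁅ x ⁆) ⟩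
    ∣ p ∩ ∁ ⁅ x ⁆ ∣ + ∣ ⁅ x ⁆ ∣         ≡⟨ cong (∣ p ∩ ∁ ⁅ x ⁆ ∣ +_) (∣⁅x⁆∣≡1 x) ⟩
    ∣ p ∩ ∁ ⁅ x ⁆ ∣ + 1                 ≡⟨ +-comm ∣ p ∩ ∁ ⁅ x ⁆ ∣ 1 ⟩
    suc ∣ p ∩ ∁ ⁅ x ⁆ ∣                 ∎
    where open ≤-Reasoning

  x∈p∩∁q⁺ : ∀ {x} {p q : Subset n} → x ∈ p → x ∉ q → x ∈ p ∩ ∁ q
  x∈p∩∁q⁺ x∈p x∉q = x∈p∩q⁺ (x∈p , x∉p⇒x∈∁p x∉q)

  x∈p∩∁q⁻ : ∀ {x} (p q : Subset n) → x ∈ p ∩ ∁ q → x ∈ p × x ∉ q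
  x∈p∩∁q⁻ p q x∈ = let x∈p , x∈∁q = x∈p∩q⁻ p (∁ q) x∈ in x∈p , x∈∁p⇒x∉p x∈∁q

  ∪-⊆ : {p q r : Subset n} → p ⊆ r → q ⊆ r → p ∪ q ⊆ r
  ∪-⊆ {p} {q} p⊆r q⊆r x∈p∪q = [ p⊆r , q⊆r ] (x∈p∪q⁻ p q x∈p∪q)

  ∪-monoˡ-⊆ : {p q : Subset n} (r : Subset n) → p ⊆ q → p ∪ r ⊆ q ∪ r
  ∪-monoˡ-⊆ {q = q} r p⊆q = ∪-⊆ (p⊆p∪q r ∘ p⊆q) (q⊆p∪q q r)

  x∈p⇒⁅x⁆⊆p : ∀ {x} {p : Subset n} → x ∈ p → ⁅ x ⁆ ⊆ p
  x∈p⇒⁅x⁆⊆p {x} {p} x∈p y∈⁅x⁆ = subst (_∈ p) (sym (x∈⁅y⁆⇒x≡y x y∈⁅x⁆)) x∈p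

  ∁[p-x]⊆∁p∪⁅x⁆ : ∀ (p : Subset n) x → ∁ (p - x) ⊆ ∁ p ∪ ⁅ x ⁆
  ∁[p-x]⊆∁p∪⁅x⁆ p x {v} v∈∁[p-x] with v ∈? p | v ≟ x
  ... | no v∉p  | _        = x∈p∪q⁺ (inj₁ (x∉p⇒x∈∁p v∉p))
  ... | yes _   | yes refl = x∈p∪q⁺ (inj₂ (x∈⁅x⁆ v))
  ... | yes v∈p | no v≢x   = contradiction (x∈p∧x≢y⇒x∈p-y v∈p v≢x) (x∈∁p⇒x∉p v∈∁[p-x])

  ∁[⊤─p]⊆p : ∀ (p : Subset n) → ∁ (⊤ ─ p) ⊆ p
  ∁[⊤─p]⊆p p {v} v∈∁[⊤─p] with v ∈? p
  ... | yes v∈p = v∈p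
  ... | no  v∉p = contradiction (x∈p∧x∉q⇒x∈p─q ∈⊤ v∉p) (x∈∁p⇒x∉p v∈∁[⊤─p])

module _ {n : ℕ} (G : Graph n) where

  Adj? : ∀ u v → Dec (Adj G u v)
  Adj? u v = adj G u v Bool.≟ Bool.true

  Adj-sym : ∀ {u v} → Adj G u v → Adj G v u
  Adj-sym {u} {v} u~v = trans (adj-sym G v u) u~v

  Adj-irrefl : ∀ {v} → ¬ Adj G v v
  Adj-irrefl {v} v~v with trans (sym v~v) (adj-irr G v)
  ... | ()

  -- A force whose target is already coloured is simply skipped.
  Forces-⊤-mono : ∀ {S S′ C D} → S ⊆ S′ → C ⊆ D → Forces G S C ⊤ → Forces G S′ D ⊤
  Forces-⊤-mono {S′ = S′} S⊆S′ C⊆D done = subst (λ E → Forces G S′ E ⊤) (⊆-antisym C⊆D ⊆⊤) done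
  Forces-⊤-mono {D = D} S⊆S′ C⊆D (more (force c u c∈S u∉C c~u others) rest) with u ∈? D
  ... | yes u∈D = Forces-⊤-mono S⊆S′ (∪-⊆ C⊆D (x∈p⇒⁅x⁆⊆p u∈D)) rest
  ... | no  u∉D = more (force c u (S⊆S′ c∈S) u∉D c~u (λ w c~w w≢u → C⊆D (others w c~w w≢u)))
                       (Forces-⊤-mono S⊆S′ (∪-monoˡ-⊆ ⁅ u ⁆ C⊆D) rest)

  module _ (J S : Subset n) where

    Pending : Subset n → Pred (Fin n) 0ℓ
    Pending C c = c ∈ S × ∃ λ w → w ∈ J × w ∉ C × Adj G c w

    pending? : ∀ C → Decidable (Pending C)
    pending? C c = c ∈? S ×-dec any? λ w → w ∈? J ×-dec ¬? (w ∈? C) ×-dec Adj? c w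

    pending : Subset n → Subset n
    pending C = subsetOf (pending? C)

    pending-antitone : ∀ {C D} → C ⊆ D → pending D ⊆ pending C
    pending-antitone C⊆D c∈ with ∈-subsetOf⁻ (pending? _) c∈
    ... | c∈S , w , w∈J , w∉D , c~w = ∈-subsetOf⁺ (pending? _) (c∈S , w , w∈J , w∉D ∘ C⊆D , c~w)

    forcing-into-J-shrinks-pending : ∀ {C c u} → c ∈ S → u ∈ J → u ∉ C → Adj G c u →
                                     (∀ w → Adj G c w → w ≢ u → w ∈ C) →
                                     pending (C ∪ ⁅ u ⁆) ⊂ pending C
    forcing-into-J-shrinks-pending {C} {c} {u} c∈S u∈J u∉C c~u others =
      pending-antitone (p⊆p∪q ⁅ u ⁆) , c ,
      ∈-subsetOf⁺ (pending? C) (c∈S , u , u∈J , u∉C , c~u) , c-done ∘ ∈-subsetOf⁻ (pending? _)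
      where
      c-done : ¬ Pending (C ∪ ⁅ u ⁆) c
      c-done (_ , w , _ , w∉C′ , c~w) with w ≟ u
      ... | yes refl = w∉C′ (q⊆p∪q C ⁅ u ⁆ (x∈⁅x⁆ u))
      ... | no  w≢u  = w∉C′ (p⊆p∪q ⁅ u ⁆ (others w c~w w≢u))

    uncoloured-after-force : ∀ {C u v} → v ∈ J ∩ ∁ C → v ≢ u → v ∈ J ∩ ∁ (C ∪ ⁅ u ⁆)
    uncoloured-after-force {C} {u} v∈ v≢u =
      let v∈J , v∉C = x∈p∩∁q⁻ J C v∈ in
      x∈p∩∁q⁺ v∈J λ v∈C∪u → [ v∉C , v≢u ∘ x∈⁅y⁆⇒x≡y u ] (x∈p∪q⁻ C ⁅ u ⁆ v∈C∪u)

    uncoloured-≤-pending : ∀ {C} → Forces G S C ⊤ → ∣ J ∩ ∁ C ∣ ≤ ∣ pending C ∣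
    uncoloured-≤-pending done = p⊆q⇒∣p∣≤∣q∣ nothing-uncoloured
      where
      nothing-uncoloured : J ∩ ∁ ⊤ ⊆ pending ⊤
      nothing-uncoloured v∈ = contradiction ∈⊤ (proj₂ (x∈p∩∁q⁻ J ⊤ v∈))
    uncoloured-≤-pending {C} (more (force c u c∈S u∉C c~u others) rest) with u ∈? J
    ... | yes u∈J = begin
      ∣ J ∩ ∁ C ∣                     ≤⟨ ∣p∣≤1+∣p∩∁⁅x⁆∣ (J ∩ ∁ C) u ⟩
      suc ∣ (J ∩ ∁ C) ∩ ∁ ⁅ u ⁆ ∣     ≤⟨ s≤s (p⊆q⇒∣p∣≤∣q∣ uncoloured-but-u) ⟩
      suc ∣ J ∩ ∁ (C ∪ ⁅ u ⁆) ∣       ≤⟨ s≤s (uncoloured-≤-pending rest) ⟩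
      suc ∣ pending (C ∪ ⁅ u ⁆) ∣     ≤⟨ p⊂q⇒∣p∣<∣q∣ (forcing-into-J-shrinks-pending c∈S u∈J u∉C c~u others) ⟩
      ∣ pending C ∣                   ∎
      where
      open ≤-Reasoning
      uncoloured-but-u : (J ∩ ∁ C) ∩ ∁ ⁅ u ⁆ ⊆ J ∩ ∁ (C ∪ ⁅ u ⁆)
      uncoloured-but-u v∈ = let v∈J∁C , v∉⁅u⁆ = x∈p∩∁q⁻ (J ∩ ∁ C) ⁅ u ⁆ v∈ in
        uncoloured-after-force v∈J∁C (x∉⁅y⁆⇒x≢y v∉⁅u⁆)
    ... | no u∉J = begin
      ∣ J ∩ ∁ C ∣                     ≤⟨ p⊆q⇒∣p∣≤∣q∣ still-uncoloured ⟩
      ∣ J ∩ ∁ (C ∪ ⁅ u ⁆) ∣           ≤⟨ uncoloured-≤-pending rest ⟩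
      ∣ pending (C ∪ ⁅ u ⁆) ∣         ≤⟨ p⊆q⇒∣p∣≤∣q∣ (pending-antitone (p⊆p∪q ⁅ u ⁆)) ⟩
      ∣ pending C ∣                   ∎
      where
      open ≤-Reasoning
      still-uncoloured : J ∩ ∁ C ⊆ J ∩ ∁ (C ∪ ⁅ u ⁆)
      still-uncoloured v∈ = uncoloured-after-force v∈ λ { refl → u∉J (proj₁ (x∈p∩∁q⁻ J C v∈)) }

    ∣independent∣≤∣czf∣ : Independent G J → IsCZFSet G S → ∣ J ∣ ≤ ∣ S ∣
    ∣independent∣≤∣czf∣ J-indep S-czf = begin
      ∣ J ∣                       ≡⟨ ∣p∣≡∣p∩∁q∣+∣p∩q∣ J S ⟩
      ∣ J ∩ ∁ S ∣ + ∣ J ∩ S ∣     ≤⟨ +-monoˡ-≤ ∣ J ∩ S ∣ (uncoloured-≤-pending S-czf) ⟩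
      ∣ pending S ∣ + ∣ J ∩ S ∣   ≤⟨ +-monoˡ-≤ ∣ J ∩ S ∣ (p⊆q⇒∣p∣≤∣q∣ pending-outside-J) ⟩
      ∣ S ∩ ∁ J ∣ + ∣ J ∩ S ∣     ≡⟨ cong (λ X → ∣ S ∩ ∁ J ∣ + ∣ X ∣) (∩-comm J S) ⟩
      ∣ S ∩ ∁ J ∣ + ∣ S ∩ J ∣     ≡⟨ sym (∣p∣≡∣p∩∁q∣+∣p∩q∣ S J) ⟩
      ∣ S ∣                       ∎
      where
      open ≤-Reasoning
      pending-outside-J : pending S ⊆ S ∩ ∁ J
      pending-outside-J {c} c∈ with ∈-subsetOf⁻ (pending? S) c∈
      ... | c∈S , w , w∈J , _ , c~w = x∈p∩∁q⁺ c∈S λ c∈J → J-indep c w c∈J w∈J c~w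

  Independent-⁅⁆-∪ : ∀ {ℓ I} → Independent G I → (∀ {v} → v ∈ I → ¬ Adj G ℓ v) →
                     Independent G (⁅ ℓ ⁆ ∪ I)
  Independent-⁅⁆-∪ {ℓ} {I} I-indep ℓ-apart u v u∈ v∈
    with x∈p∪q⁻ ⁅ ℓ ⁆ I u∈ | x∈p∪q⁻ ⁅ ℓ ⁆ I v∈
  ... | inj₂ u∈I | inj₂ v∈I = I-indep u v u∈I v∈I
  ... | inj₁ u∈ℓ | inj₂ v∈I rewrite x∈⁅y⁆⇒x≡y ℓ u∈ℓ = ℓ-apart v∈I
  ... | inj₂ u∈I | inj₁ v∈ℓ rewrite x∈⁅y⁆⇒x≡y ℓ v∈ℓ = ℓ-apart u∈I ∘ Adj-sym
  ... | inj₁ u∈ℓ | inj₁ v∈ℓ rewrite x∈⁅y⁆⇒x≡y ℓ u∈ℓ | x∈⁅y⁆⇒x≡y ℓ v∈ℓ = Adj-irrefl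

  -- z ∷ zs is the prefix of vs ending at w.
  chainTo-prefix : ∀ {x y w vs} → Linked (Adj G) (y ∷ vs) → w ∈ₗ vs → Adj G w x →
                   ∃₂ λ z zs → ChainTo G x y (z ∷ zs) × (z ∷ zs) Sublist.⊆ vs
  chainTo-prefix (y~v ∷ _) (here refl) w~x = _ , [] , (y~v , w~x) , refl ∷ minimum _
  chainTo-prefix (y~v ∷ path) (there w∈vs) w~x with chainTo-prefix path w∈vs w~x
  ... | z , zs , chain , zs⊆vs = _ , z ∷ zs , (y~v , chain) , refl ∷ zs⊆vs

  AtMostOneNeighbourIn : Subset n → Fin n → Set
  AtMostOneNeighbourIn R x = ∀ {v w} → v ∈ R → w ∈ R → Adj G x v → Adj G x w → v ≡ w

  IndependentForcerOf : Subset n → Subset n → Set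
  IndependentForcerOf R I = I ⊆ R × Independent G I × Forces G I (∁ (R ─ I)) ⊤

  isolated-step : ∀ {R ℓ I} → ℓ ∈ R → (∀ {v} → v ∈ R → ¬ Adj G ℓ v) →
                  IndependentForcerOf (R - ℓ) I → IndependentForcerOf R (⁅ ℓ ⁆ ∪ I)
  isolated-step {R} {ℓ} {I} ℓ∈R isolated (I⊆R-ℓ , I-indep , I-forces) =
    ∪-⊆ (x∈p⇒⁅x⁆⊆p ℓ∈R) (p─q⊆p R ⁅ ℓ ⁆ ∘ I⊆R-ℓ) ,
    Independent-⁅⁆-∪ I-indep (isolated ∘ p─q⊆p R ⁅ ℓ ⁆ ∘ I⊆R-ℓ) ,
    Forces-⊤-mono (q⊆p∪q ⁅ ℓ ⁆ I) (⊆-reflexive (cong ∁ (p─q─r≡p─q∪r R ⁅ ℓ ⁆ I))) I-forces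

  -- ℓ forces its only neighbour p in R; after that the colouring covers the one for R - ℓ - p.
  leaf-step : ∀ {R ℓ p I} → ℓ ∈ R → p ∈ R → Adj G ℓ p → AtMostOneNeighbourIn R ℓ →
              IndependentForcerOf (R - ℓ - p) I → IndependentForcerOf R (⁅ ℓ ⁆ ∪ I)
  leaf-step {R} {ℓ} {p} {I} ℓ∈R p∈R ℓ~p ℓ-leaf (I⊆R′ , I-indep , I-forces) =
    ∪-⊆ (x∈p⇒⁅x⁆⊆p ℓ∈R) (R′⊆R ∘ I⊆R′) ,
    Independent-⁅⁆-∪ I-indep ℓ-apart ,
    more (force ℓ p (x∈p∪q⁺ (inj₁ (x∈⁅x⁆ ℓ))) (x∈p⇒x∉∁p (x∈p∧x∉q⇒x∈p─q p∈R p∉⁅ℓ⁆∪I)) ℓ~p others-coloured)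
         (Forces-⊤-mono (q⊆p∪q ⁅ ℓ ⁆ I) colouring-grows I-forces)
    where
    R′⊆R : R - ℓ - p ⊆ R
    R′⊆R = p─q⊆p R ⁅ ℓ ⁆ ∘ p─q⊆p (R - ℓ) ⁅ p ⁆

    ℓ-apart : ∀ {v} → v ∈ I → ¬ Adj G ℓ v
    ℓ-apart v∈I ℓ~v = x∈p-y⇒x≢y (I⊆R′ v∈I) (ℓ-leaf (R′⊆R (I⊆R′ v∈I)) p∈R ℓ~v ℓ~p)

    p∉⁅ℓ⁆∪I : p ∉ ⁅ ℓ ⁆ ∪ I
    p∉⁅ℓ⁆∪I p∈ with x∈p∪q⁻ ⁅ ℓ ⁆ I p∈
    ... | inj₁ p∈⁅ℓ⁆ rewrite x∈⁅y⁆⇒x≡y ℓ p∈⁅ℓ⁆ = Adj-irrefl ℓ~p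
    ... | inj₂ p∈I   = x∈p-y⇒x≢y (I⊆R′ p∈I) refl

    others-coloured : ∀ w → Adj G ℓ w → w ≢ p → w ∈ ∁ (R ─ (⁅ ℓ ⁆ ∪ I))
    others-coloured w ℓ~w w≢p = x∉p⇒x∈∁p λ w∈ → w≢p (ℓ-leaf (p─q⊆p R _ w∈) p∈R ℓ~w ℓ~p)

    colouring-grows : ∁ (R - ℓ - p ─ I) ⊆ ∁ (R ─ (⁅ ℓ ⁆ ∪ I)) ∪ ⁅ p ⁆
    colouring-grows = begin
      ∁ (R - ℓ - p ─ I)             ≡⟨ cong ∁ (p─q─r≡p─r─q (R - ℓ) ⁅ p ⁆ I) ⟩
      ∁ (R - ℓ ─ I - p)             ≤⟨ ∁[p-x]⊆∁p∪⁅x⁆ (R - ℓ ─ I) p ⟩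
      ∁ (R - ℓ ─ I) ∪ ⁅ p ⁆         ≡⟨ cong (λ X → ∁ X ∪ ⁅ p ⁆) (p─q─r≡p─q∪r R ⁅ ℓ ⁆ I) ⟩
      ∁ (R ─ (⁅ ℓ ⁆ ∪ I)) ∪ ⁅ p ⁆   ∎
      where open ⊆-Reasoning (⊆-poset n)

  module _ (acyclic : Acyclic G) where

    no-chord : ∀ {x y w vs} → Unique (x ∷ y ∷ vs) → Linked (Adj G) (x ∷ y ∷ vs) → w ∈ₗ vs → ¬ Adj G x w
    no-chord {x} {y} unique (x~y ∷ path) w∈vs x~w with chainTo-prefix path w∈vs (Adj-sym x~w)
    ... | z , zs , chain , zs⊆vs =
      acyclic (x ∷ y ∷ z ∷ zs) (Unique-resp-⊆ (refl ∷ refl ∷ zs⊆vs) unique , s≤s (s≤s (s≤s z≤n)) , x~y , chain)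

    neighbour-on-path≡prev : ∀ {x y v vs} → Unique (x ∷ y ∷ vs) → Linked (Adj G) (x ∷ y ∷ vs) →
                             v ∈ₗ y ∷ vs → Adj G x v → v ≡ y
    neighbour-on-path≡prev _      _    (here v≡y)   _   = v≡y
    neighbour-on-path≡prev unique path (there v∈vs) x~v = contradiction x~v (no-chord unique path v∈vs)

    atMostOneNeighbour-if-on-path : ∀ {R x} rest → Unique (x ∷ rest) → Linked (Adj G) (x ∷ rest) →
                                    (∀ {v} → v ∈ R → Adj G x v → v ∈ₗ rest) → AtMostOneNeighbourIn R x
    atMostOneNeighbour-if-on-path []      _      _    on-path v∈R _ x~v _ with () ← on-path v∈R x~v
    atMostOneNeighbour-if-on-path (_ ∷ _) unique path on-path v∈R w∈R x~v x~w =
      trans (neighbour-on-path≡prev unique path (on-path v∈R x~v) x~v)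
            (sym (neighbour-on-path≡prev unique path (on-path w∈R x~w) x~w))

    module _ (R : Subset n) where
      open Countdown (≡-decSetoid n) using (_⊕_; empty; lookupOrInsert)
      open DecMembership (_≟_ {n}) using () renaming (_∈?_ to _∈ₗ?_)

      NewNeighbour : Fin n → List (Fin n) → Pred (Fin n) 0ℓ
      NewNeighbour x rest w = w ∈ R × Adj G x w × w ∉ₗ rest

      newNeighbour? : ∀ x rest → Decidable (NewNeighbour x rest)
      newNeighbour? x rest w = w ∈? R ×-dec Adj? x w ×-dec ¬? (w ∈ₗ? rest)

      -- The path x ∷ rest is extended at x for as long as possible; the
      -- countdown k bounds the number of vertices not yet on rest.
      maximal-path-end : ∀ {k} x rest → rest ⊕ k → x ∈ R → Unique (x ∷ rest) → Linked (Adj G) (x ∷ rest) →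
                         ∃ λ ℓ → ℓ ∈ R × AtMostOneNeighbourIn R ℓ
      maximal-path-end x rest counted x∈R unique path with any? (newNeighbour? x rest)
      ... | no none = x , x∈R , atMostOneNeighbour-if-on-path rest unique path on-path
        where
        on-path : ∀ {v} → v ∈ R → Adj G x v → v ∈ₗ rest
        on-path {v} v∈R x~v with v ∈ₗ? rest
        ... | yes v∈rest = v∈rest
        ... | no  v∉rest = contradiction (v , v∈R , x~v , v∉rest) none
      ... | yes (w , w∈R , x~w , w∉rest) with lookupOrInsert counted x
      ...   | inj₁ x∈rest = contradiction x∈rest (Unique[x∷xs]⇒x∉xs unique)
      ...   | inj₂ (_ , refl , counted′) =
        maximal-path-end w (x ∷ rest) counted′ w∈R (w-fresh ∷ unique) (Adj-sym x~w ∷ path)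
        where
        w-fresh : All (w ≢_) (x ∷ rest)
        w-fresh = (λ { refl → Adj-irrefl x~w }) ∷ ¬Any⇒All¬ rest w∉rest

      ∃-atMostOneNeighbourIn : ∀ {x} → x ∈ R → ∃ λ ℓ → ℓ ∈ R × AtMostOneNeighbourIn R ℓ
      ∃-atMostOneNeighbourIn x∈R = maximal-path-end _ [] (empty (↣-id (Fin n))) x∈R ([] ∷ []) [-]

    ∃-independentForcerOf : ∀ R → Acc _⊂_ R → ∃ (IndependentForcerOf R)
    ∃-independentForcerOf R (acc smaller) with nonempty? R
    ... | no R-empty = ⊥ , ⊥⊆ , (λ _ _ u∈⊥ → contradiction u∈⊥ ∉⊥) , Forces-⊤-mono ⊆-refl all-coloured done
      where
      all-coloured : ⊤ ⊆ ∁ (R ─ ⊥)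
      all-coloured {v} _ = x∉p⇒x∈∁p λ v∈ → R-empty (v , p─q⊆p R ⊥ v∈)
    ... | yes (_ , x∈R) with ∃-atMostOneNeighbourIn R x∈R
    ...   | ℓ , ℓ∈R , ℓ-leaf with any? (λ p → p ∈? R ×-dec Adj? ℓ p)
    ...     | no isolated =
      Product.map (⁅ ℓ ⁆ ∪_) (isolated-step ℓ∈R λ v∈R ℓ~v → isolated (_ , v∈R , ℓ~v))
        (∃-independentForcerOf (R - ℓ) (smaller (x∈p⇒p-x⊂p ℓ∈R)))
    ...     | yes (p , p∈R , ℓ~p) =
      Product.map (⁅ ℓ ⁆ ∪_) (leaf-step ℓ∈R p∈R ℓ~p ℓ-leaf)
        (∃-independentForcerOf (R - ℓ - p) (smaller (⊆-⊂-trans (p─q⊆p (R - ℓ) ⁅ p ⁆) (x∈p⇒p-x⊂p ℓ∈R))))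

mainTheorem9 : ∀ (n : ℕ) (T : Graph n) → IsTree T →
    Σ ℕ λ k → IsCZFNumber T k × IsIndependenceNumber T k
mainTheorem9 n T (_ , acyclic) with ∃-independentForcerOf T acyclic ⊤ (⊂-wellFounded ⊤)
... | I , _ , I-indep , I-forces =
  ∣ I ∣ , ((I , I-czf , refl) , λ S S-czf → ∣independent∣≤∣czf∣ T I S I-indep S-czf)
        , ((I , I-indep , refl) , λ J J-indep → ∣independent∣≤∣czf∣ T J I J-indep I-czf)
  where
  I-czf : IsCZFSet T I
  I-czf = Forces-⊤-mono T ⊆-refl (∁[⊤─p]⊆p I) I-forces
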